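{- Let $\mathcal A$ be the $5\times 10$ real matrix \[\mathcal A=\begin{bmatrix} I_5 & \mathcal D\end{bmatrix},\qquad \mathcal D=\begin{bmatrix} 1 & -1 & 0 & 0 & -1\\ -1 & 1 &-1 & 0 & 0\\ 0 & -1 & 1 & -1 & 0\\ 0 & 0 & -1 & 1 & -1\\ -1 & 0 & 0 & -1 & 1 \end{bmatrix},\] let $R_{10}$ be the regular matroid with ground set $E$ (the $10$ columns of $\mathcal A$) represented by $\mathcal A$ over $\mathbb R$, and let \[S(R_{10})=\frac{\mathbb Z^{E}}{\operatorname{im}_{\mathbb Z}\mathcal A^{t}\oplus \ker_{\mathbb Z}\mathcal A}\] be its sandpile group. Let $\overline{\mathcal K}=I_5+i\,\mathcal D$, a $5\times5$ matrix over the Gaussian integers $\mathbb Z[i]$. Then $S(R_{10})$ is isomorphic (as an abelian group) to $\operatorname{coker}_{\mathbb Z[i]}\overline{\mathcal K}=\mathbb Z[i]^5/\overline{\mathcal K}\,\mathbb Z[i]^5$.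
   Context: Here $\operatorname{im}_{\mathbb Z}\mathcal A^t$ is the set of integer linear combinations of the rows of $\mathcal A$, viewed as a sublattice of $\mathbb Z^{10}=\mathbb Z^E$, and $\ker_{\mathbb Z}\mathcal A=\{x\in\mathbb Z^{10}:\mathcal A x=0\}$. The matrix $\mathcal A$ is totally unimodular. -}

module Defs where

open import Data.Nat using (ℕ; zero; suc)
open import Data.Integer using (ℤ; +_; -[1+_]; _+_; _*_; -_; _-_)
open import Data.Fin using (Fin; zero; suc; splitAt)
open import Data.Sum using ([_,_])
open import Data.Vec using (Vec; []; _∷_; lookup)
open import Data.Product using (Σ; ∃; _×_; _,_)
open import Relation.Binary.PropositionalEquality using (_≡_)

ℤ^ : ℕ → Set
ℤ^ n = Fin n → ℤ

∑ : ∀ {A : Set} (zeroA : A) (plus : A → A → A) (n : ℕ) → (Fin n → A) → A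
∑ z p zero    f = z
∑ z p (suc n) f = p (f zero) (∑ z p n (λ i → f (suc i)))

∑ℤ : (n : ℕ) → (Fin n → ℤ) → ℤ
∑ℤ = ∑ (+ 0) _+_

δ : ∀ {n} → Fin n → Fin n → ℤ
δ zero    zero    = + 1
δ zero    (suc _) = + 0
δ (suc _) zero    = + 0
δ (suc i) (suc j) = δ i j

-1ℤ : ℤ
-1ℤ = -[1+ 0 ]

Dvec : Vec (Vec ℤ 5) 5
Dvec = ( + 1 ∷ -1ℤ ∷ + 0 ∷ + 0 ∷ -1ℤ ∷ [])
     ∷ ( -1ℤ ∷ + 1 ∷ -1ℤ ∷ + 0 ∷ + 0 ∷ [])
     ∷ ( + 0 ∷ -1ℤ ∷ + 1 ∷ -1ℤ ∷ + 0 ∷ [])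
     ∷ ( + 0 ∷ + 0 ∷ -1ℤ ∷ + 1 ∷ -1ℤ ∷ [])
     ∷ ( -1ℤ ∷ + 0 ∷ + 0 ∷ -1ℤ ∷ + 1 ∷ [])
     ∷ []

𝒟 : Fin 5 → Fin 5 → ℤ
𝒟 i j = lookup (lookup Dvec i) j

𝒜 : Fin 5 → Fin 10 → ℤ
𝒜 i j = [ (λ k → δ i k) , (λ k → 𝒟 i k) ] (splitAt 5 j)

𝒜· : ℤ^ 10 → ℤ^ 5
𝒜· x i = ∑ℤ 10 (λ j → 𝒜 i j * x j)

𝒜ᵗ· : ℤ^ 5 → ℤ^ 10
𝒜ᵗ· y j = ∑ℤ 5 (λ i → 𝒜 i j * y i)

In-im⊕ker : ℤ^ 10 → Set
In-im⊕ker x = Σ (ℤ^ 5) λ y → Σ (ℤ^ 10) λ k →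
  ((∀ i → 𝒜· k i ≡ + 0)) × (∀ j → x j ≡ 𝒜ᵗ· y j + k j)

_∼S_ : ℤ^ 10 → ℤ^ 10 → Set
x ∼S x' = In-im⊕ker (λ j → x j - x' j)

_+ℤ^_ : ∀ {n} → ℤ^ n → ℤ^ n → ℤ^ n
(x +ℤ^ y) j = x j + y j

record ℤ[i] : Set where
  constructor _+i_
  field
    re : ℤ
    im : ℤ
open ℤ[i] public
infix 4 _+i_

_+ᵍ_ : ℤ[i] → ℤ[i] → ℤ[i]
(a +i b) +ᵍ (c +i d) = (a + c) +i (b + d)

_-ᵍ_ : ℤ[i] → ℤ[i] → ℤ[i]
(a +i b) -ᵍ (c +i d) = (a - c) +i (b - d)

_*ᵍ_ : ℤ[i] → ℤ[i] → ℤ[i]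
(a +i b) *ᵍ (c +i d) = (a * c - b * d) +i (a * d + b * c)

ℤ[i]^ : ℕ → Set
ℤ[i]^ n = Fin n → ℤ[i]

_+ᵍ^_ : ∀ {n} → ℤ[i]^ n → ℤ[i]^ n → ℤ[i]^ n
(z +ᵍ^ w) j = z j +ᵍ w j

𝒦̄ : Fin 5 → Fin 5 → ℤ[i]
𝒦̄ i j = δ i j +i 𝒟 i j

𝒦̄· : ℤ[i]^ 5 → ℤ[i]^ 5
𝒦̄· v i = ∑ (+ 0 +i + 0) _+ᵍ_ 5 (λ j → 𝒦̄ i j *ᵍ v j)

_∼K_ : ℤ[i]^ 5 → ℤ[i]^ 5 → Set
z ∼K w = Σ (ℤ[i]^ 5) λ v → ∀ i → z i -ᵍ w i ≡ 𝒦̄· v i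

-- A group isomorphism S(R₁₀) ≅ coker 𝒦̄, given on representatives:
-- a map that is well defined on classes, additive, injective on classes
-- and surjective on classes.
record SandpileIso : Set where
  field
    f          : ℤ^ 10 → ℤ[i]^ 5
    well-def   : ∀ x y → x ∼S y → f x ∼K f y
    additive   : ∀ x y → f (x +ℤ^ y) ∼K (f x +ᵍ^ f y)
    injective  : ∀ x y → f x ∼K f y → x ∼S y
    surjective : ∀ w → Σ (ℤ^ 10) λ x → f x ∼K w

-- Split x ∈ ℤ^E as (a, b) along 𝒜 = [ I | 𝒟 ] and send it to a + i b.  Since 𝒟 is symmetric,
-- 𝒜ᵗ y = (y, 𝒟 y) and ker 𝒜 = { (- 𝒟 b, b) }, so im 𝒜ᵗ ⊕ ker 𝒜 is sent exactly onto the
-- vectors (y - 𝒟 b) + i (b + 𝒟 y) = (I + i 𝒟)(y + i b), the image of 𝒦̄.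
module Submission where

open import Defs
import Data.Nat as ℕ
open import Data.Nat using (ℕ; zero; suc)
open import Data.Integer using (ℤ; +_; _+_; _*_; -_; _-_)
open import Data.Integer.Properties
  using (_≟_; +-assoc; +-comm; +-identityˡ; +-identityʳ; +-inverseˡ; +-inverseʳ;
         *-identityˡ; *-zeroˡ; *-zeroʳ; neg-distrib-+; +-0-abelianGroup; +-commutativeSemigroup)
open import Algebra.Properties.AbelianGroup +-0-abelianGroup using (inverseˡ-unique)
open import Algebra.Properties.CommutativeSemigroup +-commutativeSemigroup using (interchange)
open import Data.Fin using (Fin; zero; suc; splitAt; _↑ˡ_; _↑ʳ_)
open import Data.Fin.Properties using (splitAt-↑ˡ; splitAt-↑ʳ; splitAt⁻¹-↑ˡ; splitAt⁻¹-↑ʳ; all?)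
open import Data.Sum using (inj₁; inj₂; [_,_])
open import Data.Product using (Σ; _×_; _,_)
open import Function using (_∘_)
open import Relation.Nullary.Decidable using (toWitness)
open import Relation.Binary.PropositionalEquality
  using (_≡_; refl; sym; trans; cong; cong₂; module ≡-Reasoning)

open ≡-Reasoning

∑ℤ-cong : ∀ n {f g : Fin n → ℤ} → (∀ i → f i ≡ g i) → ∑ℤ n f ≡ ∑ℤ n g
∑ℤ-cong zero    eq = refl
∑ℤ-cong (suc n) eq = cong₂ _+_ (eq zero) (∑ℤ-cong n (eq ∘ suc))

∑ℤ-zero : ∀ n → ∑ℤ n (λ _ → + 0) ≡ + 0
∑ℤ-zero zero    = refl
∑ℤ-zero (suc n) = trans (+-identityˡ _) (∑ℤ-zero n)

∑ℤ-+ : ∀ n (f g : Fin n → ℤ) → ∑ℤ n (λ i → f i + g i) ≡ ∑ℤ n f + ∑ℤ n g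
∑ℤ-+ zero    f g = refl
∑ℤ-+ (suc n) f g = trans (cong (_+_ (f zero + g zero)) (∑ℤ-+ n (f ∘ suc) (g ∘ suc)))
                         (interchange (f zero) (g zero) (∑ℤ n (f ∘ suc)) (∑ℤ n (g ∘ suc)))

∑ℤ-neg : ∀ n (f : Fin n → ℤ) → ∑ℤ n (λ i → - f i) ≡ - ∑ℤ n f
∑ℤ-neg zero    f = refl
∑ℤ-neg (suc n) f = trans (cong (_+_ (- f zero)) (∑ℤ-neg n (f ∘ suc)))
                         (sym (neg-distrib-+ (f zero) (∑ℤ n (f ∘ suc))))

∑ℤ-- : ∀ n (f g : Fin n → ℤ) → ∑ℤ n (λ i → f i - g i) ≡ ∑ℤ n f - ∑ℤ n g
∑ℤ-- n f g = trans (∑ℤ-+ n f (λ i → - g i)) (cong (_+_ (∑ℤ n f)) (∑ℤ-neg n g))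

∑ℤ-++ : ∀ m n (f : Fin (m ℕ.+ n) → ℤ) →
         ∑ℤ (m ℕ.+ n) f ≡ ∑ℤ m (λ i → f (i ↑ˡ n)) + ∑ℤ n (λ i → f (m ↑ʳ i))
∑ℤ-++ zero    n f = sym (+-identityˡ _)
∑ℤ-++ (suc m) n f = trans (cong (_+_ (f zero)) (∑ℤ-++ m n (f ∘ suc)))
                          (sym (+-assoc (f zero) _ _))

δ-sym : ∀ {n} (i j : Fin n) → δ i j ≡ δ j i
δ-sym zero    zero    = refl
δ-sym zero    (suc j) = refl
δ-sym (suc i) zero    = refl
δ-sym (suc i) (suc j) = δ-sym i j

∑ℤ-δˡ : ∀ n (i : Fin n) (a : Fin n → ℤ) → ∑ℤ n (λ j → δ i j * a j) ≡ a i
∑ℤ-δˡ (suc n) zero a = begin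
  + 1 * a zero + ∑ℤ n (λ j → + 0 * a (suc j))  ≡⟨ cong₂ _+_ (*-identityˡ (a zero))
                                                           (∑ℤ-cong n (λ j → *-zeroˡ (a (suc j)))) ⟩
  a zero + ∑ℤ n (λ _ → + 0)                    ≡⟨ cong (_+_ (a zero)) (∑ℤ-zero n) ⟩
  a zero + + 0                                 ≡⟨ +-identityʳ (a zero) ⟩
  a zero                                       ∎
∑ℤ-δˡ (suc n) (suc i) a = begin
  + 0 * a zero + ∑ℤ n (λ j → δ i j * a (suc j))  ≡⟨ cong₂ _+_ (*-zeroˡ (a zero)) (∑ℤ-δˡ n i (a ∘ suc)) ⟩
  + 0 + a (suc i)                                ≡⟨ +-identityˡ (a (suc i)) ⟩
  a (suc i)                                      ∎

∑ℤ-δʳ : ∀ n (i : Fin n) (a : Fin n → ℤ) → ∑ℤ n (λ j → δ j i * a j) ≡ a i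
∑ℤ-δʳ n i a = trans (∑ℤ-cong n (λ j → cong (_* a j) (δ-sym j i))) (∑ℤ-δˡ n i a)

re-∑ : ∀ n (f : Fin n → ℤ[i]) → re (∑ (+ 0 +i + 0) _+ᵍ_ n f) ≡ ∑ℤ n (re ∘ f)
re-∑ zero    f = refl
re-∑ (suc n) f = cong (_+_ (re (f zero))) (re-∑ n (f ∘ suc))

im-∑ : ∀ n (f : Fin n → ℤ[i]) → im (∑ (+ 0 +i + 0) _+ᵍ_ n f) ≡ ∑ℤ n (im ∘ f)
im-∑ zero    f = refl
im-∑ (suc n) f = cong (_+_ (im (f zero))) (im-∑ n (f ∘ suc))

-- For n = 5 and D = 𝒟, A·, Aᵗ·, K·, _∼ᴬ_ and _∼ᴷ_ unfold to 𝒜·, 𝒜ᵗ·, 𝒦̄·, _∼S_ and _∼K_.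
module SymmetricBlock {n : ℕ} (D : Fin n → Fin n → ℤ) (D-sym : ∀ i j → D i j ≡ D j i) where

  pair : ℤ^ n → ℤ^ n → ℤ^ (n ℕ.+ n)
  pair a b j = [ a , b ] (splitAt n j)

  pair-↑ˡ : ∀ a b i → pair a b (i ↑ˡ n) ≡ a i
  pair-↑ˡ a b i = cong [ a , b ] (splitAt-↑ˡ n i n)

  pair-↑ʳ : ∀ a b i → pair a b (n ↑ʳ i) ≡ b i
  pair-↑ʳ a b i = cong [ a , b ] (splitAt-↑ʳ n n i)

  toGaussian : ℤ^ (n ℕ.+ n) → ℤ[i]^ n
  toGaussian x i = x (i ↑ˡ n) +i x (n ↑ʳ i)

  toGaussian-injective : ∀ {x x'} → (∀ i → toGaussian x i ≡ toGaussian x' i) → ∀ j → x j ≡ x' j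
  toGaussian-injective eq j with splitAt n j in s
  ... | inj₁ i rewrite sym (splitAt⁻¹-↑ˡ s) = cong re (eq i)
  ... | inj₂ i rewrite sym (splitAt⁻¹-↑ʳ s) = cong im (eq i)

  A : Fin n → Fin (n ℕ.+ n) → ℤ
  A i = pair (δ i) (D i)

  A· : ℤ^ (n ℕ.+ n) → ℤ^ n
  A· x i = ∑ℤ (n ℕ.+ n) (λ j → A i j * x j)

  Aᵗ· : ℤ^ n → ℤ^ (n ℕ.+ n)
  Aᵗ· y j = ∑ℤ n (λ i → A i j * y i)

  D· : ℤ^ n → ℤ^ n
  D· y i = ∑ℤ n (λ j → D i j * y j)

  K· : ℤ[i]^ n → ℤ[i]^ n
  K· v i = ∑ (+ 0 +i + 0) _+ᵍ_ n (λ j → (δ i j +i D i j) *ᵍ v j)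

  _∼ᴬ_ : ℤ^ (n ℕ.+ n) → ℤ^ (n ℕ.+ n) → Set
  x ∼ᴬ x' = Σ (ℤ^ n) λ y → Σ (ℤ^ (n ℕ.+ n)) λ k →
    (∀ i → A· k i ≡ + 0) × (∀ j → x j - x' j ≡ Aᵗ· y j + k j)

  _∼ᴷ_ : ℤ[i]^ n → ℤ[i]^ n → Set
  z ∼ᴷ w = Σ (ℤ[i]^ n) λ v → ∀ i → z i -ᵍ w i ≡ K· v i

  A·-split : ∀ x i → A· x i ≡ x (i ↑ˡ n) + D· (λ j → x (n ↑ʳ j)) i
  A·-split x i = begin
    A· x i
      ≡⟨ ∑ℤ-++ n n (λ j → A i j * x j) ⟩
    ∑ℤ n (λ j → A i (j ↑ˡ n) * x (j ↑ˡ n)) + ∑ℤ n (λ j → A i (n ↑ʳ j) * x (n ↑ʳ j))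
      ≡⟨ cong₂ _+_ (∑ℤ-cong n (λ j → cong (_* x (j ↑ˡ n)) (pair-↑ˡ (δ i) (D i) j)))
                   (∑ℤ-cong n (λ j → cong (_* x (n ↑ʳ j)) (pair-↑ʳ (δ i) (D i) j))) ⟩
    ∑ℤ n (λ j → δ i j * x (j ↑ˡ n)) + D· (λ j → x (n ↑ʳ j)) i
      ≡⟨ cong (_+ D· (λ j → x (n ↑ʳ j)) i) (∑ℤ-δˡ n i (λ j → x (j ↑ˡ n))) ⟩
    x (i ↑ˡ n) + D· (λ j → x (n ↑ʳ j)) i ∎

  Aᵗ·-↑ˡ : ∀ y j → Aᵗ· y (j ↑ˡ n) ≡ y j
  Aᵗ·-↑ˡ y j = trans (∑ℤ-cong n (λ i → cong (_* y i) (pair-↑ˡ (δ i) (D i) j))) (∑ℤ-δʳ n j y)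

  Aᵗ·-↑ʳ : ∀ y j → Aᵗ· y (n ↑ʳ j) ≡ D· y j
  Aᵗ·-↑ʳ y j = ∑ℤ-cong n (λ i → cong (_* y i) (trans (pair-↑ʳ (δ i) (D i) j) (D-sym i j)))

  re-K· : ∀ v i → re (K· v i) ≡ re (v i) - D· (im ∘ v) i
  re-K· v i = begin
    re (K· v i)
      ≡⟨ re-∑ n _ ⟩
    ∑ℤ n (λ j → δ i j * re (v j) - D i j * im (v j))
      ≡⟨ ∑ℤ-- n _ _ ⟩
    ∑ℤ n (λ j → δ i j * re (v j)) - D· (im ∘ v) i
      ≡⟨ cong (_- D· (im ∘ v) i) (∑ℤ-δˡ n i (re ∘ v)) ⟩
    re (v i) - D· (im ∘ v) i ∎

  im-K· : ∀ v i → im (K· v i) ≡ im (v i) + D· (re ∘ v) i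
  im-K· v i = begin
    im (K· v i)
      ≡⟨ im-∑ n _ ⟩
    ∑ℤ n (λ j → δ i j * im (v j) + D i j * re (v j))
      ≡⟨ ∑ℤ-+ n _ _ ⟩
    ∑ℤ n (λ j → δ i j * im (v j)) + D· (re ∘ v) i
      ≡⟨ cong (_+ D· (re ∘ v) i) (∑ℤ-δˡ n i (im ∘ v)) ⟩
    im (v i) + D· (re ∘ v) i ∎

  D·-zero : ∀ i → D· (λ _ → + 0) i ≡ + 0
  D·-zero i = trans (∑ℤ-cong n (λ j → *-zeroʳ (D i j))) (∑ℤ-zero n)

  K·-zero : ∀ i → K· (λ _ → + 0 +i + 0) i ≡ (+ 0 +i + 0)
  K·-zero i = cong₂ _+i_ (trans (re-K· _ i) (cong (_-_ (+ 0)) (D·-zero i)))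
                         (trans (im-K· _ i) (trans (+-identityˡ _) (D·-zero i)))

  ≡⇒∼ᴷ : ∀ z w → (∀ i → z i ≡ w i) → z ∼ᴷ w
  ≡⇒∼ᴷ z w eq = (λ _ → + 0 +i + 0) , λ i → begin
    z i -ᵍ w i      ≡⟨ cong (_-ᵍ w i) (eq i) ⟩
    w i -ᵍ w i      ≡⟨ cong₂ _+i_ (+-inverseʳ (re (w i))) (+-inverseʳ (im (w i))) ⟩
    + 0 +i + 0      ≡⟨ sym (K·-zero i) ⟩
    K· (λ _ → + 0 +i + 0) i ∎

  kerVector : ℤ^ n → ℤ^ (n ℕ.+ n)
  kerVector b = pair (λ i → - D· b i) b

  kerVector-∈-ker : ∀ b i → A· (kerVector b) i ≡ + 0
  kerVector-∈-ker b i = begin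
    A· (kerVector b) i
      ≡⟨ A·-split (kerVector b) i ⟩
    kerVector b (i ↑ˡ n) + D· (λ j → kerVector b (n ↑ʳ j)) i
      ≡⟨ cong₂ _+_ (pair-↑ˡ _ b i) (∑ℤ-cong n (λ j → cong (D i j *_) (pair-↑ʳ _ b j))) ⟩
    - D· b i + D· b i
      ≡⟨ +-inverseˡ (D· b i) ⟩
    + 0 ∎

  ker⇒kerVector : ∀ {k} → (∀ i → A· k i ≡ + 0) → ∀ j → k j ≡ kerVector (λ i → k (n ↑ʳ i)) j
  ker⇒kerVector {k} k∈ker = toGaussian-injective λ i →
    cong₂ _+i_ (trans (inverseˡ-unique _ _ (trans (sym (A·-split k i)) (k∈ker i)))
                      (sym (pair-↑ˡ _ _ i)))
               (sym (pair-↑ʳ _ _ i))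

  toGaussian-image : ∀ y b i → toGaussian (Aᵗ· y +ℤ^ kerVector b) i ≡ K· (λ j → y j +i b j) i
  toGaussian-image y b i = cong₂ _+i_
    (begin
      Aᵗ· y (i ↑ˡ n) + kerVector b (i ↑ˡ n) ≡⟨ cong₂ _+_ (Aᵗ·-↑ˡ y i) (pair-↑ˡ _ b i) ⟩
      y i - D· b i                          ≡⟨ sym (re-K· _ i) ⟩
      re (K· (λ j → y j +i b j) i)          ∎)
    (begin
      Aᵗ· y (n ↑ʳ i) + kerVector b (n ↑ʳ i) ≡⟨ cong₂ _+_ (Aᵗ·-↑ʳ y i) (pair-↑ʳ _ b i) ⟩
      D· y i + b i                          ≡⟨ +-comm (D· y i) (b i) ⟩
      b i + D· y i                          ≡⟨ sym (im-K· _ i) ⟩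
      im (K· (λ j → y j +i b j) i)          ∎)

  ∼ᴬ⇒toGaussian-∼ᴷ : ∀ x x' → x ∼ᴬ x' → toGaussian x ∼ᴷ toGaussian x'
  ∼ᴬ⇒toGaussian-∼ᴷ x x' (y , k , k∈ker , x-x'≡) = (λ j → y j +i k (n ↑ʳ j)) , λ i →
    trans (cong₂ _+i_ (x-x'≡′ (i ↑ˡ n)) (x-x'≡′ (n ↑ʳ i))) (toGaussian-image y _ i)
    where
    x-x'≡′ : ∀ j → x j - x' j ≡ (Aᵗ· y +ℤ^ kerVector (λ i → k (n ↑ʳ i))) j
    x-x'≡′ j = trans (x-x'≡ j) (cong (_+_ (Aᵗ· y j)) (ker⇒kerVector k∈ker j))

  toGaussian-+ : ∀ x x' → toGaussian (x +ℤ^ x') ∼ᴷ (toGaussian x +ᵍ^ toGaussian x')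
  toGaussian-+ x x' = ≡⇒∼ᴷ (toGaussian (x +ℤ^ x')) _ (λ _ → refl)

  toGaussian-∼ᴷ⇒∼ᴬ : ∀ x x' → toGaussian x ∼ᴷ toGaussian x' → x ∼ᴬ x'
  toGaussian-∼ᴷ⇒∼ᴬ x x' (v , eq) = re ∘ v , kerVector (im ∘ v) , kerVector-∈-ker (im ∘ v) ,
    toGaussian-injective (λ i → trans (eq i) (sym (toGaussian-image (re ∘ v) (im ∘ v) i)))

  toGaussian-surjective : ∀ w → Σ (ℤ^ (n ℕ.+ n)) λ x → toGaussian x ∼ᴷ w
  toGaussian-surjective w = pair (re ∘ w) (im ∘ w) ,
    ≡⇒∼ᴷ _ w (λ i → cong₂ _+i_ (pair-↑ˡ (re ∘ w) (im ∘ w) i) (pair-↑ʳ (re ∘ w) (im ∘ w) i))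

𝒟-symmetric : ∀ i j → 𝒟 i j ≡ 𝒟 j i
𝒟-symmetric = toWitness {a? = all? λ i → all? λ j → 𝒟 i j ≟ 𝒟 j i} _

open SymmetricBlock 𝒟 𝒟-symmetric

proposition3p2 : SandpileIso
proposition3p2 = record
  { f          = toGaussian
  ; well-def   = ∼ᴬ⇒toGaussian-∼ᴷ
  ; additive   = toGaussian-+
  ; injective  = toGaussian-∼ᴷ⇒∼ᴬ
  ; surjective = toGaussian-surjective
  }
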